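{- Let $r\ge1$ and $n\ge 4r+2$ be integers, let $C_n$ be the cycle with vertices $x_1,\dots,x_n$ labeled consecutively (indices taken modulo $n$), and let $D\subseteq V(C_n)$. Then $D$ is an $r$-identifying code of $C_n$ if and only if (1) for every $i\in\{1,\dots,n\}$, $x_i\in D$ or $x_{i+2r+1}\in D$; and (2) there are no $2r+1$ consecutive vertices of $C_n$ none of which is in $D$.
   Context: For a graph $G=(V,E)$ and integer $r\ge1$, $d(x,y)$ is the number of edges in a shortest path between $x$ and $y$, $N_r[x]=\{y\in V: d(x,y)\le r\}$, and for $D\subseteq V$, $D_r(x)=N_r[x]\cap D$. A set $D\subseteq V$ is an $r$-identifying code of $G$ if $D_r(x)\neq\emptyset$ for every $x\in V$ and $D_r(x)\neq D_r(y)$ for all distinct $x,y\in V$. -}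

module Defs where

open import Data.Nat using (ℕ; zero; suc; _+_; _*_; _≤_; _<_; NonZero)
open import Data.Nat.DivMod using (_mod_)
open import Data.Fin using (Fin; toℕ)
open import Data.Fin.Subset using (Subset; _∈_; _∉_)
open import Data.Product using (Σ; ∃; _×_; _,_)
open import Data.Sum using (_⊎_)
open import Relation.Binary.PropositionalEquality using (_≡_)
open import Relation.Nullary using (¬_)
open import Function.Bundles using (_⇔_)

Graph : ℕ → Set₁
Graph n = Fin n → Fin n → Set

data Walk {n : ℕ} (G : Graph n) : Fin n → Fin n → ℕ → Set where
  here : ∀ {x} → Walk G x x 0
  step : ∀ {x y z k} → G x y → Walk G y z k → Walk G x z (suc k)

-- d(x,y) ≤ r : there is a path (equivalently, walk) of at most r edges from x to y.
dist≤ : ∀ {n} → Graph n → ℕ → Fin n → Fin n → Set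
dist≤ G r x y = ∃ λ k → k ≤ r × Walk G x y k

-- y ∈ D_r(x) = N_r[x] ∩ D
_∈D[_,_,_] : ∀ {n} → Fin n → Graph n → ℕ → Subset n × Fin n → Set
y ∈D[ G , r , (D , x) ] = (y ∈ D) × dist≤ G r x y

IsIdentifyingCode : ∀ {n} → Graph n → ℕ → Subset n → Set
IsIdentifyingCode {n} G r D =
  (∀ x → ∃ λ y → y ∈D[ G , r , (D , x) ]) ×
  (∀ x y → ¬ (x ≡ y) → ¬ (∀ z → (z ∈D[ G , r , (D , x) ]) ⇔ (z ∈D[ G , r , (D , y) ])))

-- Vertex x_{i+k} with indices mod n (vertices x_1..x_n represented as Fin n = 0..n-1).
shift : ∀ {n} .{{_ : NonZero n}} → Fin n → ℕ → Fin n
shift {n} i k = (toℕ i + k) mod n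

Cycle : (n : ℕ) .{{_ : NonZero n}} → Graph n
Cycle n x y = (y ≡ shift x 1) ⊎ (x ≡ shift y 1)

module Submission where

-- For r ≥ 0 and n ≥ 4r + 2, D is an r-identifying code of
-- the cycle C_n iff (1) x_i ∈ D or x_{i+2r+1} ∈ D for every i, and (2) D meets every run of
-- 2r + 1 consecutive vertices.
--
-- The proof replaces distances by windows.  The ball N_r[x] is the window of the 2r + 1
-- consecutive vertices x - r, …, x + r, so the code D_r(x) is determined by the vertices
-- of D in the window starting at x - r, and two vertices have equal codes iff their
-- windows agree on D.

open import Defs
open import Data.Nat
open import Data.Nat.Properties
open import Data.Nat.DivMod using (_%_; m%n<n; m%n%n≡m%n; m<n⇒m%n≡m; [m+n]%n≡m%n; %-distribˡ-+)
open import Data.Nat.Tactic.RingSolver using (solve-∀)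
open import Data.Fin using (Fin; toℕ)
open import Data.Fin.Properties using (toℕ-injective; toℕ-fromℕ<; toℕ<n)
open import Data.Fin.Subset using (Subset; _∈_; _∉_)
open import Data.Fin.Subset.Properties using (_∈?_)
open import Data.Product using (∃; ∃₂; _×_; _,_; proj₂)
open import Data.Sum using (_⊎_; inj₁; inj₂; [_,_]′)
open import Relation.Nullary using (¬_; yes; no; contradiction)
open import Relation.Binary.PropositionalEquality
open import Function.Bundles using (_⇔_; mk⇔; Equivalence)
open ≡-Reasoning

module CycleGeometry (n : ℕ) .{{_ : NonZero n}} where

  toℕ-shift : ∀ x k → toℕ (shift x k) ≡ (toℕ x + k) % n
  toℕ-shift x k = toℕ-fromℕ< (m%n<n (toℕ x + k) n)

  %-absorbˡ : ∀ a b → (a % n + b) % n ≡ (a + b) % n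
  %-absorbˡ a b = begin
    (a % n + b) % n          ≡⟨ %-distribˡ-+ (a % n) b n ⟩
    (a % n % n + b % n) % n  ≡⟨ cong (λ t → (t + b % n) % n) (m%n%n≡m%n a n) ⟩
    (a % n + b % n) % n      ≡⟨ %-distribˡ-+ a b n ⟨
    (a + b) % n              ∎

  %-absorbʳ : ∀ a b → (a + b % n) % n ≡ (a + b) % n
  %-absorbʳ a b = begin
    (a + b % n) % n  ≡⟨ cong (_% n) (+-comm a (b % n)) ⟩
    (b % n + a) % n  ≡⟨ %-absorbˡ b a ⟩
    (b + a) % n      ≡⟨ cong (_% n) (+-comm b a) ⟩
    (a + b) % n      ∎

  shift-+ : ∀ x a b → shift (shift x a) b ≡ shift x (a + b)
  shift-+ x a b = toℕ-injective (begin
    toℕ (shift (shift x a) b)  ≡⟨ toℕ-shift (shift x a) b ⟩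
    (toℕ (shift x a) + b) % n  ≡⟨ cong (λ t → (t + b) % n) (toℕ-shift x a) ⟩
    ((toℕ x + a) % n + b) % n  ≡⟨ %-absorbˡ (toℕ x + a) b ⟩
    (toℕ x + a + b) % n        ≡⟨ cong (_% n) (+-assoc (toℕ x) a b) ⟩
    (toℕ x + (a + b)) % n      ≡⟨ toℕ-shift x (a + b) ⟨
    toℕ (shift x (a + b))      ∎)

  shift-comm : ∀ x a b → shift (shift x a) b ≡ shift (shift x b) a
  shift-comm x a b = begin
    shift (shift x a) b  ≡⟨ shift-+ x a b ⟩
    shift x (a + b)      ≡⟨ cong (shift x) (+-comm a b) ⟩
    shift x (b + a)      ≡⟨ shift-+ x b a ⟨
    shift (shift x b) a  ∎

  -- toℕ x is already reduced, so shifting by 0 or by a full turn n is the identity.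
  shift-0 : ∀ x → shift x 0 ≡ x
  shift-0 x = toℕ-injective (begin
    toℕ (shift x 0)  ≡⟨ toℕ-shift x 0 ⟩
    (toℕ x + 0) % n  ≡⟨ cong (_% n) (+-identityʳ (toℕ x)) ⟩
    toℕ x % n        ≡⟨ m<n⇒m%n≡m (toℕ<n x) ⟩
    toℕ x            ∎)

  shift-n : ∀ x → shift x n ≡ x
  shift-n x = toℕ-injective (begin
    toℕ (shift x n)  ≡⟨ toℕ-shift x n ⟩
    (toℕ x + n) % n  ≡⟨ [m+n]%n≡m%n (toℕ x) n ⟩
    toℕ x % n        ≡⟨ m<n⇒m%n≡m (toℕ<n x) ⟩
    toℕ x            ∎)

  shift-unshift : ∀ x {k} → k ≤ n → shift (shift x k) (n ∸ k) ≡ x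
  shift-unshift x {k} k≤n = begin
    shift (shift x k) (n ∸ k)  ≡⟨ shift-+ x k (n ∸ k) ⟩
    shift x (k + (n ∸ k))      ≡⟨ cong (shift x) (m+[n∸m]≡n k≤n) ⟩
    shift x n                  ≡⟨ shift-n x ⟩
    x                          ∎

  shift-cancel : ∀ {x y k} → k ≤ n → shift x k ≡ shift y k → x ≡ y
  shift-cancel {x} {y} {k} k≤n eq = begin
    x                          ≡⟨ shift-unshift x k≤n ⟨
    shift (shift x k) (n ∸ k)  ≡⟨ cong (λ t → shift t (n ∸ k)) eq ⟩
    shift (shift y k) (n ∸ k)  ≡⟨ shift-unshift y k≤n ⟩
    y                          ∎

  -- offset a z is the number of steps (less than n) from a to z.
  offset : Fin n → Fin n → ℕ
  offset a z = (toℕ z + (n ∸ toℕ a)) % n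

  -- The arithmetic behind both offset lemmas: a + (p + (n ∸ a)) is p plus a full turn.
  offset-turn : ∀ a p → (toℕ a + (p + (n ∸ toℕ a))) % n ≡ p % n
  offset-turn a p = begin
    (toℕ a + (p + (n ∸ toℕ a))) % n  ≡⟨ cong (_% n) (+-assoc (toℕ a) p _) ⟨
    (toℕ a + p + (n ∸ toℕ a)) % n    ≡⟨ cong (λ t → (t + (n ∸ toℕ a)) % n) (+-comm (toℕ a) p) ⟩
    (p + toℕ a + (n ∸ toℕ a)) % n    ≡⟨ cong (_% n) (+-assoc p (toℕ a) _) ⟩
    (p + (toℕ a + (n ∸ toℕ a))) % n  ≡⟨ cong (λ t → (p + t) % n) (m+[n∸m]≡n (<⇒≤ (toℕ<n a))) ⟩
    (p + n) % n                      ≡⟨ [m+n]%n≡m%n p n ⟩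
    p % n                            ∎

  shift-offset : ∀ a z → shift a (offset a z) ≡ z
  shift-offset a z = toℕ-injective (begin
    toℕ (shift a (offset a z))           ≡⟨ toℕ-shift a (offset a z) ⟩
    (toℕ a + offset a z) % n             ≡⟨ %-absorbʳ (toℕ a) _ ⟩
    (toℕ a + (toℕ z + (n ∸ toℕ a))) % n  ≡⟨ offset-turn a (toℕ z) ⟩
    toℕ z % n                            ≡⟨ m<n⇒m%n≡m (toℕ<n z) ⟩
    toℕ z                                ∎)

  offset-shift : ∀ a {p} → p < n → offset a (shift a p) ≡ p
  offset-shift a {p} p<n = begin
    (toℕ (shift a p) + (n ∸ toℕ a)) % n  ≡⟨ cong (λ t → (t + (n ∸ toℕ a)) % n) (toℕ-shift a p) ⟩
    ((toℕ a + p) % n + (n ∸ toℕ a)) % n  ≡⟨ %-absorbˡ (toℕ a + p) _ ⟩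
    (toℕ a + p + (n ∸ toℕ a)) % n        ≡⟨ cong (_% n) (+-assoc (toℕ a) p _) ⟩
    (toℕ a + (p + (n ∸ toℕ a))) % n      ≡⟨ offset-turn a p ⟩
    p % n                                ≡⟨ m<n⇒m%n≡m p<n ⟩
    p                                    ∎

  shift-injective : ∀ a {p q} → p < n → q < n → shift a p ≡ shift a q → p ≡ q
  shift-injective a {p} {q} p<n q<n eq = begin
    p                     ≡⟨ offset-shift a p<n ⟨
    offset a (shift a p)  ≡⟨ cong (offset a) eq ⟩
    offset a (shift a q)  ≡⟨ offset-shift a q<n ⟩
    q                     ∎

  -- A walk makes a steps forward and b steps backward, so x + a = z + b.
  walk-balance : ∀ {x z k} → Walk (Cycle n) x z k → ∃₂ λ a b → a + b ≡ k × shift x a ≡ shift z b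
  walk-balance here = 0 , 0 , refl , refl
  walk-balance {x} {z} (step {y = y} (inj₁ y≡x+1) w) with walk-balance w
  ... | a , b , a+b≡k , eq = suc a , b , cong suc a+b≡k , (begin
    shift x (1 + a)      ≡⟨ shift-+ x 1 a ⟨
    shift (shift x 1) a  ≡⟨ cong (λ t → shift t a) y≡x+1 ⟨
    shift y a            ≡⟨ eq ⟩
    shift z b            ∎)
  walk-balance {x} {z} (step {y = y} (inj₂ x≡y+1) w) with walk-balance w
  ... | a , b , a+b≡k , eq = a , suc b , trans (+-suc a b) (cong suc a+b≡k) , (begin
    shift x a            ≡⟨ cong (λ t → shift t a) x≡y+1 ⟩
    shift (shift y 1) a  ≡⟨ shift-comm y 1 a ⟩
    shift (shift y a) 1  ≡⟨ cong (λ t → shift t 1) eq ⟩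
    shift (shift z b) 1  ≡⟨ shift-+ z b 1 ⟩
    shift z (b + 1)      ≡⟨ cong (shift z) (+-comm b 1) ⟩
    shift z (suc b)      ∎)

  walk-forward : ∀ x k → Walk (Cycle n) x (shift x k) k
  walk-forward x zero    = subst (λ t → Walk (Cycle n) x t 0) (sym (shift-0 x)) here
  walk-forward x (suc k) = step (inj₁ refl)
    (subst (λ t → Walk (Cycle n) (shift x 1) t k) (shift-+ x 1 k) (walk-forward (shift x 1) k))

  walk-backward : ∀ z k → Walk (Cycle n) (shift z k) z k
  walk-backward z zero    = subst (λ t → Walk (Cycle n) t z 0) (sym (shift-0 z)) here
  walk-backward z (suc k) = step (inj₂ (trans (cong (shift z) (+-comm 1 k)) (sym (shift-+ z k 1))))
    (walk-backward z k)

  Window : ℕ → Fin n → Fin n → Set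
  Window m a z = ∃ λ j → j < m × z ≡ shift a j

  window-slide⁺ : ∀ {m a z} → Window m a z → ¬ z ≡ a → Window m (shift a 1) z
  window-slide⁺ {a = a} (zero , _ , z≡a+0) z≢a = contradiction (trans z≡a+0 (shift-0 a)) z≢a
  window-slide⁺ {a = a} (suc j , j+1<m , z≡) z≢a =
    j , <-trans (n<1+n j) j+1<m , trans z≡ (sym (shift-+ a 1 j))

  window-slide⁻ : ∀ {m a z} → Window m (shift a 1) z → ¬ z ≡ shift a m → Window m a z
  window-slide⁻ {m} {a} {z} (j , j<m , z≡) z≢a+m with suc j ≟ m
  ... | yes j+1≡m = contradiction (trans z≡ (trans (shift-+ a 1 j) (cong (shift a) j+1≡m))) z≢a+m
  ... | no  j+1≢m = suc j , ≤∧≢⇒< j<m j+1≢m , trans z≡ (shift-+ a 1 j)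

  -- before x r is the vertex r steps before x, where the window of N_r[x] starts.
  before : Fin n → ℕ → Fin n
  before x r = shift x (n ∸ r)

  shift-before : ∀ x {r} → r ≤ n → shift (before x r) r ≡ x
  shift-before x {r} r≤n = begin
    shift (shift x (n ∸ r)) r  ≡⟨ shift-+ x (n ∸ r) r ⟩
    shift x (n ∸ r + r)        ≡⟨ cong (shift x) (m∸n+n≡m r≤n) ⟩
    shift x n                  ≡⟨ shift-n x ⟩
    x                          ∎

  <2r+1⇒≤r+r : ∀ r {j} → j < 2 * r + 1 → j ≤ r + r
  <2r+1⇒≤r+r r j<2r+1 = s≤s⁻¹ (≤-trans j<2r+1 (≤-reflexive (2r+1≡suc[r+r] r)))
    where
      2r+1≡suc[r+r] : ∀ r → 2 * r + 1 ≡ suc (r + r)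
      2r+1≡suc[r+r] = solve-∀

  ≤r+r⇒<2r+1 : ∀ r {j} → j ≤ r + r → j < 2 * r + 1
  ≤r+r⇒<2r+1 r j≤r+r = ≤-trans (s≤s j≤r+r) (≤-reflexive (suc[r+r]≡2r+1 r))
    where
      suc[r+r]≡2r+1 : ∀ r → suc (r + r) ≡ 2 * r + 1
      suc[r+r]≡2r+1 = solve-∀

  -- The ball N_r[x] is the window of the 2r + 1 vertices x - r, …, x + r: a walk with a
  -- forward and b backward steps (a + b ≤ r) ends at position r + a ∸ b of that window.
  ball⇒window : ∀ {r x z} → r ≤ n → dist≤ (Cycle n) r x z → Window (2 * r + 1) (before x r) z
  ball⇒window {r} {x} {z} r≤n (k , k≤r , w) with walk-balance w
  ... | a , b , refl , eq = r + a ∸ b , in-range , shift-cancel (≤-trans b≤r r≤n) (begin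
    shift z b                       ≡⟨ eq ⟨
    shift x a                       ≡⟨ cong (λ t → shift t a) (shift-before x r≤n) ⟨
    shift (shift s r) a             ≡⟨ shift-+ s r a ⟩
    shift s (r + a)                 ≡⟨ cong (shift s) (m∸n+n≡m (≤-trans b≤r (m≤m+n r a))) ⟨
    shift s (r + a ∸ b + b)         ≡⟨ shift-+ s (r + a ∸ b) b ⟨
    shift (shift s (r + a ∸ b)) b   ∎)
    where
      s = before x r
      b≤r : b ≤ r
      b≤r = ≤-trans (m≤n+m b a) k≤r
      in-range : r + a ∸ b < 2 * r + 1
      in-range = ≤r+r⇒<2r+1 r (≤-trans (m∸n≤m (r + a) b) (+-monoʳ-≤ r (≤-trans (m≤m+n a b) k≤r)))

  -- Conversely position j of the window is reached by |j - r| steps forward or backward.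
  window⇒ball : ∀ {r x z} → r ≤ n → Window (2 * r + 1) (before x r) z → dist≤ (Cycle n) r x z
  window⇒ball {r} {x} {z} r≤n (j , j<2r+1 , z≡) with r ≤? j
  ... | yes r≤j = j ∸ r , j∸r≤r ,
    subst (λ t → Walk (Cycle n) x t (j ∸ r)) x+[j∸r]≡z (walk-forward x (j ∸ r))
    where
      j∸r≤r : j ∸ r ≤ r
      j∸r≤r = ≤-trans (∸-monoˡ-≤ r (<2r+1⇒≤r+r r j<2r+1)) (≤-reflexive (m+n∸m≡n r r))
      x+[j∸r]≡z : shift x (j ∸ r) ≡ z
      x+[j∸r]≡z = begin
        shift x (j ∸ r)                      ≡⟨ cong (λ t → shift t (j ∸ r)) (shift-before x r≤n) ⟨
        shift (shift (before x r) r) (j ∸ r) ≡⟨ shift-+ (before x r) r (j ∸ r) ⟩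
        shift (before x r) (r + (j ∸ r))     ≡⟨ cong (shift (before x r)) (m+[n∸m]≡n r≤j) ⟩
        shift (before x r) j                 ≡⟨ z≡ ⟨
        z                                    ∎
  ... | no r≰j = r ∸ j , m∸n≤m r j ,
    subst (λ t → Walk (Cycle n) t z (r ∸ j)) z+[r∸j]≡x (walk-backward z (r ∸ j))
    where
      z+[r∸j]≡x : shift z (r ∸ j) ≡ x
      z+[r∸j]≡x = begin
        shift z (r ∸ j)                      ≡⟨ cong (λ t → shift t (r ∸ j)) z≡ ⟩
        shift (shift (before x r) j) (r ∸ j) ≡⟨ shift-+ (before x r) j (r ∸ j) ⟩
        shift (before x r) (j + (r ∸ j))     ≡⟨ cong (shift (before x r)) (m+[n∸m]≡n (<⇒≤ (≰⇒> r≰j))) ⟩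
        shift (before x r) r                 ≡⟨ shift-before x r≤n ⟩
        x                                    ∎

module CodesInCycles (n : ℕ) .{{_ : NonZero n}} (r : ℕ) (4r+2≤n : 4 * r + 2 ≤ n) (D : Subset n) where
  open CycleGeometry n

  width : ℕ
  width = 2 * r + 1

  width+width≤n : width + width ≤ n
  width+width≤n = ≤-trans (≤-reflexive (double-width r)) 4r+2≤n
    where
      double-width : ∀ r → 2 * r + 1 + (2 * r + 1) ≡ 4 * r + 2
      double-width = solve-∀

  r<width : r < width
  r<width = ≤r+r⇒<2r+1 r (m≤m+n r r)

  width<n : width < n
  width<n = <-≤-trans (m<m+n width (≤-<-trans z≤n r<width)) width+width≤n

  r≤n : r ≤ n
  r≤n = <⇒≤ (<-trans r<width width<n)

  PairCondition : Set
  PairCondition = ∀ (i : Fin n) → (i ∈ D) ⊎ (shift i width ∈ D)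

  NoGap : Set
  NoGap = ¬ (∃ λ (i : Fin n) → ∀ (k : ℕ) → k < width → shift i k ∉ D)

  SameCode : Fin n → Fin n → Set
  SameCode x y = ∀ z → (z ∈D[ Cycle n , r , (D , x) ]) ⇔ (z ∈D[ Cycle n , r , (D , y) ])

  AgreeOnD : Fin n → Fin n → Set
  AgreeOnD a b = ∀ z → z ∈ D → Window width a z ⇔ Window width b z

  agree-sym : ∀ {a b} → AgreeOnD a b → AgreeOnD b a
  agree-sym agree z z∈D = mk⇔ (Equivalence.from (agree z z∈D)) (Equivalence.to (agree z z∈D))

  -- Since D_r(x) consists of the D-vertices of the window of x, codes are compared via windows.
  same-code⇔agree : ∀ {x y} → SameCode x y ⇔ AgreeOnD (before x r) (before y r)
  same-code⇔agree = mk⇔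
    (λ same z z∈D → mk⇔ (restrict (Equivalence.to (same z)) z∈D)
                        (restrict (Equivalence.from (same z)) z∈D))
    (λ agree z → mk⇔ (extend (λ z∈D → Equivalence.to (agree z z∈D)))
                     (extend (λ z∈D → Equivalence.from (agree z z∈D))))
    where
      restrict : ∀ {u v z} → (z ∈D[ Cycle n , r , (D , u) ] → z ∈D[ Cycle n , r , (D , v) ]) →
                 z ∈ D → Window width (before u r) z → Window width (before v r) z
      restrict see z∈D win = ball⇒window r≤n (proj₂ (see (z∈D , window⇒ball r≤n win)))
      extend : ∀ {u v z} → (z ∈ D → Window width (before u r) z → Window width (before v r) z) →
               z ∈D[ Cycle n , r , (D , u) ] → z ∈D[ Cycle n , r , (D , v) ]
      extend see (z∈D , ball) = z∈D , window⇒ball r≤n (see z∈D (ball⇒window r≤n ball))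

  window-meets-D : NoGap → ∀ a → ∃ λ z → z ∈ D × Window width a z
  window-meets-D noGap a with anyUpTo? (λ k → shift a k ∈? D) width
  ... | yes (j , j<width , a+j∈D) = shift a j , a+j∈D , j , j<width , refl
  ... | no none = contradiction (a , λ k k<width a+k∈D → none (k , k<width , a+k∈D)) noGap

  -- A window missing D is the ball N_r[i + r] of a vertex with empty code.
  identifying⇒noGap : IsIdentifyingCode (Cycle n) r D → NoGap
  identifying⇒noGap (nonempty , _) (i , gap) with nonempty (shift i r)
  ... | z , z∈D , ball with ball⇒window r≤n ball
  ... | j , j<width , z≡ =
    gap j j<width (subst (_∈ D) (trans z≡ (cong (λ t → shift t j) (shift-unshift i r≤n))) z∈D)

  -- If i ∉ D and i + 2r + 1 ∉ D, the windows at i and i + 1 agree on D,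
  -- so i + r and i + 1 + r have the same code.
  identifying⇒pair : IsIdentifyingCode (Cycle n) r D → PairCondition
  identifying⇒pair (_ , separated) i with i ∈? D | shift i width ∈? D
  ... | yes i∈D | _           = inj₁ i∈D
  ... | no _    | yes last∈D  = inj₂ last∈D
  ... | no i∉D  | no last∉D   = contradiction same (separated x y x≢y)
    where
      x y : Fin n
      x = shift i r
      y = shift (shift i 1) r
      x≢y : ¬ x ≡ y
      x≢y eq = <⇒≢ (n<1+n r)
        (shift-injective i (<-trans r<width width<n) (≤-<-trans r<width width<n) (trans eq (shift-+ i 1 r)))
      adjacent : AgreeOnD i (shift i 1)
      adjacent z z∈D = mk⇔ (λ win → window-slide⁺ win (λ z≡i → i∉D (subst (_∈ D) z≡i z∈D)))
                         (λ win → window-slide⁻ win (λ z≡last → last∉D (subst (_∈ D) z≡last z∈D)))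
      same : SameCode x y
      same = Equivalence.from same-code⇔agree
        (subst₂ AgreeOnD (sym (shift-unshift i r≤n)) (sym (shift-unshift (shift i 1) r≤n)) adjacent)

  -- Windows starting d ∈ [1, 2r + 1] apart: a lies only in the first, a + 2r + 1 only in
  -- the second, and (1) puts one of them in D.
  near-windows-differ : PairCondition → ∀ a {d} → 1 ≤ d → d ≤ width → ¬ AgreeOnD a (shift a d)
  near-windows-differ pair a {d} 1≤d d≤width agree = [ first∉D , last∉D ]′ (pair a)
    where
      first∉D : a ∉ D
      first∉D a∈D with Equivalence.to (agree a a∈D) (0 , ≤-<-trans z≤n r<width , sym (shift-0 a))
      ... | j , j<width , a≡ = <⇒≢ (≤-trans 1≤d (m≤m+n d j))
        (shift-injective a (≤-<-trans z≤n width<n)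
                           (<-≤-trans (+-mono-≤-< d≤width j<width) width+width≤n)
          (trans (shift-0 a) (trans a≡ (shift-+ a d j))))
      last∉D : shift a width ∉ D
      last∉D last∈D with Equivalence.from (agree (shift a width) last∈D) in-second
        where
          in-second : Window width (shift a d) (shift a width)
          in-second = width ∸ d , ∸-monoʳ-< 1≤d d≤width ,
            trans (cong (shift a) (sym (m+[n∸m]≡n d≤width))) (sym (shift-+ a d (width ∸ d)))
      ... | j , j<width , last≡ =
        <⇒≢ j<width (sym (shift-injective a width<n (<-trans j<width width<n) last≡))

  -- Windows starting d apart with 2r + 1 < d and d + 2r + 1 < n are disjoint; (2) puts a
  -- vertex of D in the first.
  far-windows-differ : NoGap → ∀ a {d} → width < d → d + width < n → ¬ AgreeOnD a (shift a d)
  far-windows-differ noGap a {d} width<d d+width<n agree with window-meets-D noGap a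
  ... | z , z∈D , first@(j , j<width , z≡) with Equivalence.to (agree z z∈D) first
  ... | j′ , j′<width , z≡′ = <⇒≢ (<-≤-trans (<-trans j<width width<d) (m≤m+n d j′))
    (shift-injective a (<-trans j<width width<n) (<-trans (+-monoʳ-< d j′<width) d+width<n)
      (trans (sym z≡) (trans z≡′ (shift-+ a d j′))))

  -- Any two distinct windows differ on D: the start of one is d steps after the other
  -- with d ≤ 2r + 1, or n ∸ d ≤ 2r + 1, or neither.
  distinct-windows-differ : PairCondition → NoGap → ∀ a {d} → 0 < d → d < n → ¬ AgreeOnD a (shift a d)
  distinct-windows-differ pair noGap a {d} 0<d d<n with d ≤? width | n ∸ d ≤? width
  ... | yes d≤width | _ = near-windows-differ pair a 0<d d≤width
  ... | no _ | yes n∸d≤width = λ agree →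
    near-windows-differ pair (shift a d) (m<n⇒0<n∸m d<n) n∸d≤width
    (subst (AgreeOnD (shift a d)) (sym (shift-unshift a (<⇒≤ d<n))) (agree-sym agree))
  ... | no d≰width | no n∸d≰width = far-windows-differ noGap a (≰⇒> d≰width)
    (<-≤-trans (+-monoʳ-< d (≰⇒> n∸d≰width)) (≤-reflexive (m+[n∸m]≡n (<⇒≤ d<n))))

  -- Distinct vertices x and y = x + d have windows starting d apart.
  pair∧noGap⇒separated : PairCondition → NoGap → ∀ x y → ¬ x ≡ y → ¬ SameCode x y
  pair∧noGap⇒separated pair noGap x y x≢y same =
    distinct-windows-differ pair noGap (before x r) 0<d d<n agree
    where
      d = offset x y
      d<n : d < n
      d<n = m%n<n _ n
      0<d : 0 < d
      0<d = n≢0⇒n>0 (λ d≡0 → x≢y (begin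
        x                    ≡⟨ shift-0 x ⟨
        shift x 0            ≡⟨ cong (shift x) d≡0 ⟨
        shift x (offset x y) ≡⟨ shift-offset x y ⟩
        y                    ∎))
      agree : AgreeOnD (before x r) (shift (before x r) d)
      agree = subst (AgreeOnD (before x r))
        (trans (cong (λ t → before t r) (sym (shift-offset x y))) (shift-comm x d (n ∸ r)))
        (Equivalence.to same-code⇔agree same)

  noGap⇒codes-nonempty : NoGap → ∀ x → ∃ λ z → z ∈D[ Cycle n , r , (D , x) ]
  noGap⇒codes-nonempty noGap x with window-meets-D noGap (before x r)
  ... | z , z∈D , win = z , z∈D , window⇒ball r≤n win

  characterisation : IsIdentifyingCode (Cycle n) r D ⇔ (PairCondition × NoGap)
  characterisation = mk⇔
    (λ code → identifying⇒pair code , identifying⇒noGap code)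
    (λ (pair , noGap) → noGap⇒codes-nonempty noGap , pair∧noGap⇒separated pair noGap)

lemma2 : (r n : ℕ) .{{_ : NonZero n}} → 1 ≤ r → 4 * r + 2 ≤ n → (D : Subset n) →
    IsIdentifyingCode (Cycle n) r D ⇔
      ((∀ (i : Fin n) → (i ∈ D) ⊎ (shift i (2 * r + 1) ∈ D)) ×
       ¬ (∃ λ (i : Fin n) → ∀ (k : ℕ) → k < 2 * r + 1 → shift i k ∉ D))
lemma2 r n _ 4r+2≤n D = CodesInCycles.characterisation n r 4r+2≤n D
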